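{- Let $k\ge 0$ and let $\varphi$ be a formula of the language of $\mathsf{HA}$ (not containing $\$$). (1) If $\varphi\in\Pi_k$, then $\mathsf{HA}^{\$}+\mathrm{LEM}(\Sigma_k)\vdash \varphi^{\$}\leftrightarrow(\varphi\lor\$)$. (2) If $\varphi\in\Sigma_k$, then $\mathsf{HA}^{\$}+\mathrm{LEM}(\Sigma_k)\vdash \varphi^{\$}\leftrightarrow(\varphi\lor\$)$.
   Context: $\mathsf{HA}$ is intuitionistic first-order (Heyting) arithmetic, formulated with function symbols for all primitive recursive functions and logical constants $\forall,\exists,\to,\land,\lor,\perp$; $\neg\varphi$ abbreviates $\varphi\to\perp$. $\Sigma_0=\Pi_0$ is the class of quantifier-free formulas; $\Sigma_{k+1}$ consists of formulas $\exists x_1\cdots\exists x_n\,\varphi$ with $\varphi\in\Pi_k$, and $\Pi_{k+1}$ of formulas $\forall x_1\cdots\forall x_n\,\varphi$ with $\varphi\in\Sigma_k$. $\mathrm{LEM}(\Sigma_k)$ is the scheme $\varphi\lor\neg\varphi$ for $\varphi\in\Sigma_k$ (free variables allowed). $\mathsf{HA}^{\$}$ is $\mathsf{HA}$ formulated in the language extended by a $0$-ary predicate symbol $\$$ (all axiom schemes, including induction, range over the extended language); $\mathsf{HA}^{\$}+\mathrm{LEM}(\Sigma_k)$ adds $\mathrm{LEM}(\Sigma_k)$ only for formulas of the original language of $\mathsf{HA}$. Write $\neg_{\$}\varphi$ for $\varphi\to\$$. The $\$$-translation $\varphi^{\$}$ is defined inductively: $P^{\$}:\equiv\neg_{\$}\neg_{\$}P$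 for prime $P\not\equiv\perp$; $\perp^{\$}:\equiv\$$; $(\varphi_1\land\varphi_2)^{\$}:\equiv\varphi_1^{\$}\land\varphi_2^{\$}$; $(\varphi_1\to\varphi_2)^{\$}:\equiv\varphi_1^{\$}\to\varphi_2^{\$}$; $(\varphi_1\lor\varphi_2)^{\$}:\equiv\neg_{\$}\neg_{\$}(\varphi_1^{\$}\lor\varphi_2^{\$})$; $(\forall x\varphi)^{\$}:\equiv\forall x\varphi^{\$}$; $(\exists x\varphi)^{\$}:\equiv\neg_{\$}\neg_{\$}\exists x\varphi^{\$}$. -}

module Defs where

open import Data.Nat using (ℕ; zero; suc)
open import Data.Fin using (Fin; toℕ)
open import Data.Vec using (Vec; []; _∷_; lookup; tabulate)
import Data.Vec as Vec
open import Data.List using (List; []; _∷_)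
import Data.List as List
open import Data.List.Membership.Propositional using (_∈_)
open import Data.Product using (_×_)
open import Data.Unit using (⊤)
open import Data.Empty using (⊥)

-- Primitive recursive function symbols (indexed by arity).
-- rec f g : h(0, x⃗) = f(x⃗), h(S y, x⃗) = g(y, h(y, x⃗), x⃗)

data PR : ℕ → Set where
  Zero : PR 0
  Succ : PR 1
  Proj : ∀ {n} → Fin n → PR n
  Comp : ∀ {m n} → PR m → Vec (PR n) m → PR n
  Rec  : ∀ {n} → PR n → PR (suc (suc n)) → PR (suc n)

data Term : Set where
  var : ℕ → Term
  app : ∀ {n} → PR n → Vec Term n → Term

𝟘 : Term
𝟘 = app Zero []

S : Term → Term
S t = app Succ (t ∷ [])

Subst : Set
Subst = ℕ → Term

mutual
  substT : Subst → Term → Term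
  substT σ (var x) = σ x
  substT σ (app f ts) = app f (substTs σ ts)

  substTs : ∀ {n} → Subst → Vec Term n → Vec Term n
  substTs σ [] = []
  substTs σ (t ∷ ts) = substT σ t ∷ substTs σ ts

shiftT : Term → Term
shiftT = substT (λ x → var (suc x))

lift : Subst → Subst
lift σ zero = var zero
lift σ (suc x) = shiftT (σ x)

infixr 6 _∧_
infixr 5 _∨_
infixr 4 _⇒_
infix 3 _⇔_
infix 9 _ˢ
infix 8 _≐_

data Form : Set where
  _≐_ : Term → Term → Form
  ⊥'  : Form
  $   : Form
  _∧_ : Form → Form → Form
  _∨_ : Form → Form → Form
  _⇒_ : Form → Form → Form
  ∀'  : Form → Form   -- binds de Bruijn variable 0
  ∃'  : Form → Form

¬'_ : Form → Form
¬' φ = φ ⇒ ⊥'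

¬$_ : Form → Form
¬$ φ = φ ⇒ $

_⇔_ : Form → Form → Form
φ ⇔ ψ = (φ ⇒ ψ) ∧ (ψ ⇒ φ)

subst : Subst → Form → Form
subst σ (s ≐ t) = substT σ s ≐ substT σ t
subst σ ⊥' = ⊥'
subst σ $ = $
subst σ (φ ∧ ψ) = subst σ φ ∧ subst σ ψ
subst σ (φ ∨ ψ) = subst σ φ ∨ subst σ ψ
subst σ (φ ⇒ ψ) = subst σ φ ⇒ subst σ ψ
subst σ (∀' φ) = ∀' (subst (lift σ) φ)
subst σ (∃' φ) = ∃' (subst (lift σ) φ)

shift : Form → Form
shift = subst (λ x → var (suc x))

sub0 : Term → Subst
sub0 t zero = t
sub0 t (suc x) = var x

_[_] : Form → Term → Form
φ [ t ] = subst (sub0 t) φ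

NoDollar : Form → Set
NoDollar (s ≐ t) = ⊤
NoDollar ⊥' = ⊤
NoDollar $ = ⊥
NoDollar (φ ∧ ψ) = NoDollar φ × NoDollar ψ
NoDollar (φ ∨ ψ) = NoDollar φ × NoDollar ψ
NoDollar (φ ⇒ ψ) = NoDollar φ × NoDollar ψ
NoDollar (∀' φ) = NoDollar φ
NoDollar (∃' φ) = NoDollar φ

data QF : Form → Set where
  qf-≐ : ∀ s t → QF (s ≐ t)
  qf-⊥ : QF ⊥'
  qf-$ : QF $
  qf-∧ : ∀ {φ ψ} → QF φ → QF ψ → QF (φ ∧ ψ)
  qf-∨ : ∀ {φ ψ} → QF φ → QF ψ → QF (φ ∨ ψ)
  qf-⇒ : ∀ {φ ψ} → QF φ → QF ψ → QF (φ ⇒ ψ)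

mutual
  data Sigma : ℕ → Form → Set where
    Σ0    : ∀ {φ} → QF φ → Sigma 0 φ
    Σbase : ∀ {k φ} → Pi k φ → Sigma (suc k) φ
    Σ∃    : ∀ {k φ} → Sigma (suc k) φ → Sigma (suc k) (∃' φ)

  data Pi : ℕ → Form → Set where
    Π0    : ∀ {φ} → QF φ → Pi 0 φ
    Πbase : ∀ {k φ} → Sigma k φ → Pi (suc k) φ
    Π∀    : ∀ {k φ} → Pi (suc k) φ → Pi (suc k) (∀' φ)

-- Axioms of HA^$ (induction over the whole extended language)

vars : (n : ℕ) → Vec Term n
vars n = tabulate (λ i → var (toℕ i))

data HA$-Ax : Form → Set where
  ax-S≢0  : HA$-Ax (¬' (S (var 0) ≐ 𝟘))
  ax-Sinj : HA$-Ax (S (var 0) ≐ S (var 1) ⇒ var 0 ≐ var 1)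
  ax-proj : ∀ {n} (i : Fin n) → HA$-Ax (app (Proj i) (vars n) ≐ lookup (vars n) i)
  ax-comp : ∀ {m n} (f : PR m) (gs : Vec (PR n) m) →
            HA$-Ax (app (Comp f gs) (vars n) ≐ app f (Vec.map (λ g → app g (vars n)) gs))
  ax-rec0 : ∀ {n} (f : PR n) (g : PR (suc (suc n))) →
            HA$-Ax (app (Rec f g) (𝟘 ∷ vars n) ≐ app f (vars n))
  ax-recS : ∀ {n} (f : PR n) (g : PR (suc (suc n))) →
            HA$-Ax (app (Rec f g) (S (var n) ∷ vars n)
                     ≐ app g (var n ∷ app (Rec f g) (var n ∷ vars n) ∷ vars n))
  ax-ind  : ∀ (φ : Form) →
            HA$-Ax ((φ [ 𝟘 ] ∧ ∀' (φ ⇒ subst (λ { zero → S (var 0) ; (suc x) → var (suc x) }) φ))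
                     ⇒ ∀' φ)

data HA$+LEM (k : ℕ) : Form → Set where
  ha  : ∀ {φ} → HA$-Ax φ → HA$+LEM k φ
  lem : ∀ {φ} → NoDollar φ → Sigma k φ → HA$+LEM k (φ ∨ ¬' φ)

shiftCtx : List Form → List Form
shiftCtx = List.map shift

infix 2 _⊢_∶_
data _⊢_∶_ (T : Form → Set) : List Form → Form → Set where
  ax    : ∀ {Γ φ} → T φ → T ⊢ Γ ∶ φ
  hyp   : ∀ {Γ φ} → φ ∈ Γ → T ⊢ Γ ∶ φ
  ⊥E    : ∀ {Γ φ} → T ⊢ Γ ∶ ⊥' → T ⊢ Γ ∶ φ
  ⇒I    : ∀ {Γ φ ψ} → T ⊢ φ ∷ Γ ∶ ψ → T ⊢ Γ ∶ φ ⇒ ψ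
  ⇒E    : ∀ {Γ φ ψ} → T ⊢ Γ ∶ φ ⇒ ψ → T ⊢ Γ ∶ φ → T ⊢ Γ ∶ ψ
  ∧I    : ∀ {Γ φ ψ} → T ⊢ Γ ∶ φ → T ⊢ Γ ∶ ψ → T ⊢ Γ ∶ φ ∧ ψ
  ∧E₁   : ∀ {Γ φ ψ} → T ⊢ Γ ∶ φ ∧ ψ → T ⊢ Γ ∶ φ
  ∧E₂   : ∀ {Γ φ ψ} → T ⊢ Γ ∶ φ ∧ ψ → T ⊢ Γ ∶ ψ
  ∨I₁   : ∀ {Γ φ ψ} → T ⊢ Γ ∶ φ → T ⊢ Γ ∶ φ ∨ ψ
  ∨I₂   : ∀ {Γ φ ψ} → T ⊢ Γ ∶ ψ → T ⊢ Γ ∶ φ ∨ ψ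
  ∨E    : ∀ {Γ φ ψ χ} → T ⊢ Γ ∶ φ ∨ ψ → T ⊢ φ ∷ Γ ∶ χ → T ⊢ ψ ∷ Γ ∶ χ → T ⊢ Γ ∶ χ
  ∀I    : ∀ {Γ φ} → T ⊢ shiftCtx Γ ∶ φ → T ⊢ Γ ∶ ∀' φ
  ∀E    : ∀ {Γ φ} (t : Term) → T ⊢ Γ ∶ ∀' φ → T ⊢ Γ ∶ φ [ t ]
  ∃I    : ∀ {Γ φ} (t : Term) → T ⊢ Γ ∶ φ [ t ] → T ⊢ Γ ∶ ∃' φ
  ∃E    : ∀ {Γ φ ψ} → T ⊢ Γ ∶ ∃' φ → T ⊢ φ ∷ shiftCtx Γ ∶ shift ψ → T ⊢ Γ ∶ ψ
  refl≐ : ∀ {Γ} (t : Term) → T ⊢ Γ ∶ t ≐ t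
  subst≐ : ∀ {Γ s t} (φ : Form) → T ⊢ Γ ∶ s ≐ t → T ⊢ Γ ∶ φ [ s ] → T ⊢ Γ ∶ φ [ t ]

_ˢ : Form → Form
(s ≐ t) ˢ = ¬$ ¬$ (s ≐ t)
⊥' ˢ = $
$ ˢ = ¬$ ¬$ $
(φ ∧ ψ) ˢ = φ ˢ ∧ ψ ˢ
(φ ⇒ ψ) ˢ = φ ˢ ⇒ ψ ˢ
(φ ∨ ψ) ˢ = ¬$ ¬$ (φ ˢ ∨ ψ ˢ)
(∀' φ) ˢ = ∀' (φ ˢ)
(∃' φ) ˢ = ¬$ ¬$ ∃' (φ ˢ)

module Submission where

-- Call the dual φ* of a prenex formula φ the formula obtained by pushing a negation through
-- its quantifier prefix. For φ ∈ Σ_j ∪ Π_j with j ≤ k, LEM(Σ_k) proves φ ∨ φ*: at a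
-- universal quantifier ∀x ψ one applies LEM to the Σ_k formula ∃x ψ*. Using only the
-- decidability of quantifier-free formulas, φ → φ^$ and φ* → ¬_$ φ^$, while $ → φ^$ holds
-- for every φ. Thus φ^$ → φ ∨ $ follows by cases on φ ∨ φ*, and φ ∨ $ → φ^$ is immediate.

open import Defs
open import Data.Nat using (ℕ; zero; suc)
open import Data.List using ([]; _∷_)
open import Data.Product using (_×_; _,_)
open import Data.Unit using (tt)
open import Data.Vec using (Vec; []; _∷_)
open import Data.List.Relation.Unary.Any using (here; there)
open import Data.List.Relation.Binary.Subset.Propositional using (_⊆_)
open import Data.List.Relation.Binary.Subset.Propositional.Properties using (map⁺; ∷⁺ʳ)
open import Relation.Binary.PropositionalEquality as Eq using (_≡_; refl; sym; cong; cong₂)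
open Eq.≡-Reasoning

↑ : Subst
↑ x = var (suc x)

mutual
  substT-∘ : ∀ {σ τ ρ : Subst} → (∀ x → ρ x ≡ substT τ (σ x)) →
             ∀ t → substT τ (substT σ t) ≡ substT ρ t
  substT-∘ h (var x) = sym (h x)
  substT-∘ h (app f ts) = cong (app f) (substTs-∘ h ts)

  substTs-∘ : ∀ {n} {σ τ ρ : Subst} → (∀ x → ρ x ≡ substT τ (σ x)) →
              (ts : Vec Term n) → substTs τ (substTs σ ts) ≡ substTs ρ ts
  substTs-∘ h [] = refl
  substTs-∘ h (t ∷ ts) = cong₂ _∷_ (substT-∘ h t) (substTs-∘ h ts)

lift-∘ : ∀ {σ τ ρ : Subst} → (∀ x → ρ x ≡ substT τ (σ x)) →
         ∀ x → lift ρ x ≡ substT (lift τ) (lift σ x)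
lift-∘ h zero = refl
lift-∘ {σ} {τ} {ρ} h (suc x) = begin
  shiftT (ρ x)                     ≡⟨ cong shiftT (h x) ⟩
  shiftT (substT τ (σ x))          ≡⟨ substT-∘ (λ _ → refl) (σ x) ⟩
  substT (λ y → shiftT (τ y)) (σ x) ≡⟨ substT-∘ (λ _ → refl) (σ x) ⟨
  substT (lift τ) (shiftT (σ x))   ∎

subst-∘ : ∀ {σ τ ρ : Subst} → (∀ x → ρ x ≡ substT τ (σ x)) →
          ∀ φ → subst τ (subst σ φ) ≡ subst ρ φ
subst-∘ h (s ≐ t) = cong₂ _≐_ (substT-∘ h s) (substT-∘ h t)
subst-∘ h ⊥' = refl
subst-∘ h $ = refl
subst-∘ h (φ ∧ ψ) = cong₂ _∧_ (subst-∘ h φ) (subst-∘ h ψ)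
subst-∘ h (φ ∨ ψ) = cong₂ _∨_ (subst-∘ h φ) (subst-∘ h ψ)
subst-∘ h (φ ⇒ ψ) = cong₂ _⇒_ (subst-∘ h φ) (subst-∘ h ψ)
subst-∘ h (∀' φ) = cong ∀' (subst-∘ (lift-∘ h) φ)
subst-∘ h (∃' φ) = cong ∃' (subst-∘ (lift-∘ h) φ)

mutual
  substT-id : ∀ {σ : Subst} → (∀ x → σ x ≡ var x) → ∀ t → substT σ t ≡ t
  substT-id h (var x) = h x
  substT-id h (app f ts) = cong (app f) (substTs-id h ts)

  substTs-id : ∀ {n} {σ : Subst} → (∀ x → σ x ≡ var x) →
               (ts : Vec Term n) → substTs σ ts ≡ ts
  substTs-id h [] = refl
  substTs-id h (t ∷ ts) = cong₂ _∷_ (substT-id h t) (substTs-id h ts)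

lift-id : ∀ {σ : Subst} → (∀ x → σ x ≡ var x) → ∀ x → lift σ x ≡ var x
lift-id h zero = refl
lift-id h (suc x) = cong shiftT (h x)

subst-id : ∀ {σ : Subst} → (∀ x → σ x ≡ var x) → ∀ φ → subst σ φ ≡ φ
subst-id h (s ≐ t) = cong₂ _≐_ (substT-id h s) (substT-id h t)
subst-id h ⊥' = refl
subst-id h $ = refl
subst-id h (φ ∧ ψ) = cong₂ _∧_ (subst-id h φ) (subst-id h ψ)
subst-id h (φ ∨ ψ) = cong₂ _∨_ (subst-id h φ) (subst-id h ψ)
subst-id h (φ ⇒ ψ) = cong₂ _⇒_ (subst-id h φ) (subst-id h ψ)
subst-id h (∀' φ) = cong ∀' (subst-id (lift-id h) φ)
subst-id h (∃' φ) = cong ∃' (subst-id (lift-id h) φ)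

lift↑-[var0] : ∀ φ → subst (lift ↑) φ [ var 0 ] ≡ φ
lift↑-[var0] φ = Eq.trans (subst-∘ {ρ = var} lift↑-then-var0 φ) (subst-id (λ _ → refl) φ)
  where
  lift↑-then-var0 : ∀ x → var x ≡ substT (sub0 (var 0)) (lift ↑ x)
  lift↑-then-var0 zero = refl
  lift↑-then-var0 (suc x) = refl

mutual
  Σ-suc : ∀ {j φ} → Sigma j φ → Sigma (suc j) φ
  Σ-suc (Σ0 q) = Σbase (Π0 q)
  Σ-suc (Σbase p) = Σbase (Π-suc p)
  Σ-suc (Σ∃ s) = Σ∃ (Σ-suc s)

  Π-suc : ∀ {j φ} → Pi j φ → Pi (suc j) φ
  Π-suc (Π0 q) = Πbase (Σ0 q)
  Π-suc (Πbase s) = Πbase (Σ-suc s)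
  Π-suc (Π∀ p) = Π∀ (Π-suc p)

dual : Form → Form
dual (∀' φ) = ∃' (dual φ)
dual (∃' φ) = ∀' (dual φ)
dual φ = ¬' φ

dual-QF : ∀ {q} → QF q → dual q ≡ ¬' q
dual-QF (qf-≐ s t) = refl
dual-QF qf-⊥ = refl
dual-QF qf-$ = refl
dual-QF (qf-∧ a b) = refl
dual-QF (qf-∨ a b) = refl
dual-QF (qf-⇒ a b) = refl

QF-dual : ∀ {q} → QF q → QF (dual q)
QF-dual q = Eq.subst QF (sym (dual-QF q)) (qf-⇒ q qf-⊥)

NoDollar-dual : ∀ φ → NoDollar φ → NoDollar (dual φ)
NoDollar-dual (s ≐ t) nd = nd , tt
NoDollar-dual ⊥' nd = nd , tt
NoDollar-dual (φ ∧ ψ) nd = nd , tt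
NoDollar-dual (φ ∨ ψ) nd = nd , tt
NoDollar-dual (φ ⇒ ψ) nd = nd , tt
NoDollar-dual (∀' φ) nd = NoDollar-dual φ nd
NoDollar-dual (∃' φ) nd = NoDollar-dual φ nd

mutual
  dual-Σ : ∀ {j φ} → Sigma j φ → Pi j (dual φ)
  dual-Σ (Σ0 q) = Π0 (QF-dual q)
  dual-Σ (Σbase p) = Πbase (dual-Π p)
  dual-Σ (Σ∃ s) = Π∀ (dual-Σ s)

  dual-Π : ∀ {j φ} → Pi j φ → Sigma j (dual φ)
  dual-Π (Π0 q) = Σ0 (QF-dual q)
  dual-Π (Πbase s) = Σbase (dual-Σ s)
  dual-Π (Π∀ p) = Σ∃ (dual-Π p)

LEM : (Form → Set) → ℕ → Set
LEM T j = ∀ {ψ} → NoDollar ψ → Sigma j ψ → T ⊢ [] ∶ ψ ∨ ¬' ψ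

LEM-pred : ∀ {T j} → LEM T (suc j) → LEM T j
LEM-pred lemⱼ nd s = lemⱼ nd (Σ-suc s)

LEM-zero : ∀ {T} j → LEM T j → LEM T 0
LEM-zero zero lem₀ = lem₀
LEM-zero (suc j) lemⱼ = LEM-zero j (LEM-pred lemⱼ)

module Derivations (T : Form → Set) where

  cast : ∀ {Γ φ ψ} → φ ≡ ψ → T ⊢ Γ ∶ φ → T ⊢ Γ ∶ ψ
  cast = Eq.subst (T ⊢ _ ∶_)

  weaken : ∀ {Γ Δ φ} → Γ ⊆ Δ → T ⊢ Γ ∶ φ → T ⊢ Δ ∶ φ
  weaken Γ⊆Δ (ax a) = ax a
  weaken Γ⊆Δ (hyp φ∈Γ) = hyp (Γ⊆Δ φ∈Γ)
  weaken Γ⊆Δ (⊥E d) = ⊥E (weaken Γ⊆Δ d)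
  weaken Γ⊆Δ (⇒I d) = ⇒I (weaken (∷⁺ʳ _ Γ⊆Δ) d)
  weaken Γ⊆Δ (⇒E d e) = ⇒E (weaken Γ⊆Δ d) (weaken Γ⊆Δ e)
  weaken Γ⊆Δ (∧I d e) = ∧I (weaken Γ⊆Δ d) (weaken Γ⊆Δ e)
  weaken Γ⊆Δ (∧E₁ d) = ∧E₁ (weaken Γ⊆Δ d)
  weaken Γ⊆Δ (∧E₂ d) = ∧E₂ (weaken Γ⊆Δ d)
  weaken Γ⊆Δ (∨I₁ d) = ∨I₁ (weaken Γ⊆Δ d)
  weaken Γ⊆Δ (∨I₂ d) = ∨I₂ (weaken Γ⊆Δ d)
  weaken Γ⊆Δ (∨E d e f) = ∨E (weaken Γ⊆Δ d) (weaken (∷⁺ʳ _ Γ⊆Δ) e) (weaken (∷⁺ʳ _ Γ⊆Δ) f)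
  weaken Γ⊆Δ (∀I d) = ∀I (weaken (map⁺ shift Γ⊆Δ) d)
  weaken Γ⊆Δ (∀E t d) = ∀E t (weaken Γ⊆Δ d)
  weaken Γ⊆Δ (∃I t d) = ∃I t (weaken Γ⊆Δ d)
  weaken Γ⊆Δ (∃E d e) = ∃E (weaken Γ⊆Δ d) (weaken (∷⁺ʳ _ (map⁺ shift Γ⊆Δ)) e)
  weaken Γ⊆Δ (refl≐ t) = refl≐ t
  weaken Γ⊆Δ (subst≐ φ d e) = subst≐ φ (weaken Γ⊆Δ d) (weaken Γ⊆Δ e)

  weaken₀ : ∀ {Γ φ} → T ⊢ [] ∶ φ → T ⊢ Γ ∶ φ
  weaken₀ = weaken (λ ())

  apply : ∀ {Γ φ ψ} → T ⊢ [] ∶ φ ⇒ ψ → T ⊢ Γ ∶ φ → T ⊢ Γ ∶ ψ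
  apply f = ⇒E (weaken₀ f)

  #0 : ∀ {Γ a} → T ⊢ a ∷ Γ ∶ a
  #0 = hyp (here refl)

  #1 : ∀ {Γ a b} → T ⊢ b ∷ a ∷ Γ ∶ a
  #1 = hyp (there (here refl))

  #2 : ∀ {Γ a b c} → T ⊢ c ∷ b ∷ a ∷ Γ ∶ a
  #2 = hyp (there (there (here refl)))

  #3 : ∀ {Γ a b c d} → T ⊢ d ∷ c ∷ b ∷ a ∷ Γ ∶ a
  #3 = hyp (there (there (there (here refl))))

  ∀E-var0 : ∀ {Γ φ} → T ⊢ Γ ∶ shift (∀' φ) → T ⊢ Γ ∶ φ
  ∀E-var0 {φ = φ} d = cast (lift↑-[var0] φ) (∀E (var 0) d)

  ∃I-var0 : ∀ {Γ φ} → T ⊢ Γ ∶ φ → T ⊢ Γ ∶ shift (∃' φ)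
  ∃I-var0 {φ = φ} d = ∃I (var 0) (cast (sym (lift↑-[var0] φ)) d)

  ∀-mono : ∀ {φ ψ} → T ⊢ [] ∶ φ ⇒ ψ → T ⊢ [] ∶ ∀' φ ⇒ ∀' ψ
  ∀-mono f = ⇒I (∀I (apply f (∀E-var0 #0)))

  ∃-mono : ∀ {φ ψ} → T ⊢ [] ∶ φ ⇒ ψ → T ⊢ [] ∶ ∃' φ ⇒ ∃' ψ
  ∃-mono f = ⇒I (∃E #0 (∃I-var0 (apply f #0)))

module DollarTranslation (T : Form → Set) (lem₀ : LEM T 0) where

  open Derivations T

  decide-QF : ∀ {Γ q} → QF q → NoDollar q → T ⊢ Γ ∶ q ∨ ¬' q
  decide-QF q nd = weaken₀ (lem₀ nd (Σ0 q))

  $⇒¬$¬$ : ∀ {φ} → T ⊢ [] ∶ $ ⇒ ¬$ ¬$ φ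
  $⇒¬$¬$ = ⇒I (⇒I #1)

  $⇒ˢ : ∀ φ → T ⊢ [] ∶ $ ⇒ φ ˢ
  $⇒ˢ (s ≐ t) = $⇒¬$¬$
  $⇒ˢ ⊥' = ⇒I #0
  $⇒ˢ $ = $⇒¬$¬$
  $⇒ˢ (φ ∧ ψ) = ⇒I (∧I (apply ($⇒ˢ φ) #0) (apply ($⇒ˢ ψ) #0))
  $⇒ˢ (φ ∨ ψ) = $⇒¬$¬$
  $⇒ˢ (φ ⇒ ψ) = ⇒I (⇒I (apply ($⇒ˢ ψ) #1))
  $⇒ˢ (∀' φ) = ⇒I (∀I (apply ($⇒ˢ φ) #0))
  $⇒ˢ (∃' φ) = $⇒¬$¬$

  mutual
    ˢ⇒∨$-QF : ∀ {q} → QF q → NoDollar q → T ⊢ [] ∶ q ˢ ⇒ q ∨ $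
    ˢ⇒∨$-QF (qf-≐ s t) nd =
      ⇒I (∨E (decide-QF (qf-≐ s t) nd) (∨I₁ #0) (∨I₂ (⇒E #1 (⇒I (⊥E (⇒E #1 #0))))))
    ˢ⇒∨$-QF qf-⊥ _ = ⇒I (∨I₂ #0)
    ˢ⇒∨$-QF (qf-∧ a b) (nda , ndb) =
      ⇒I (∨E (apply (ˢ⇒∨$-QF a nda) (∧E₁ #0))
             (∨E (apply (ˢ⇒∨$-QF b ndb) (∧E₂ #1)) (∨I₁ (∧I #1 #0)) (∨I₂ #0))
             (∨I₂ #0))
    ˢ⇒∨$-QF (qf-∨ a b) nd@(nda , ndb) =
      ⇒I (∨E (decide-QF (qf-∨ a b) nd) (∨I₁ #0)
             (∨I₂ (⇒E #1 (⇒I (∨E #0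
               (∨E (apply (ˢ⇒∨$-QF a nda) #0) (⊥E (⇒E #3 (∨I₁ #0))) #0)
               (∨E (apply (ˢ⇒∨$-QF b ndb) #0) (⊥E (⇒E #3 (∨I₂ #0))) #0))))))
    ˢ⇒∨$-QF (qf-⇒ a b) (nda , ndb) =
      ⇒I (∨E (decide-QF a nda)
             (∨E (apply (ˢ⇒∨$-QF b ndb) (⇒E #1 (apply (⇒ˢ-QF a nda) #0)))
                 (∨I₁ (⇒I #1))
                 (∨I₂ #0))
             (∨I₁ (⇒I (⊥E (⇒E #1 #0)))))

    ⇒ˢ-QF : ∀ {q} → QF q → NoDollar q → T ⊢ [] ∶ q ⇒ q ˢ
    ⇒ˢ-QF (qf-≐ s t) _ = ⇒I (⇒I (⇒E #0 #1))
    ⇒ˢ-QF qf-⊥ _ = ⇒I (⊥E #0)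
    ⇒ˢ-QF (qf-∧ a b) (nda , ndb) =
      ⇒I (∧I (apply (⇒ˢ-QF a nda) (∧E₁ #0)) (apply (⇒ˢ-QF b ndb) (∧E₂ #0)))
    ⇒ˢ-QF (qf-∨ a b) (nda , ndb) =
      ⇒I (⇒I (⇒E #0 (∨E #1 (∨I₁ (apply (⇒ˢ-QF a nda) #0)) (∨I₂ (apply (⇒ˢ-QF b ndb) #0)))))
    ⇒ˢ-QF (qf-⇒ {ψ = b'} a b) (nda , ndb) =
      ⇒I (⇒I (∨E (apply (ˢ⇒∨$-QF a nda) #0)
                 (apply (⇒ˢ-QF b ndb) (⇒E #2 #0))
                 (apply ($⇒ˢ b') #0)))

  dual⇒¬$ˢ-QF : ∀ {q} → QF q → NoDollar q → T ⊢ [] ∶ dual q ⇒ ¬$ (q ˢ)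
  dual⇒¬$ˢ-QF {q} qf nd = cast (cong (λ χ → χ ⇒ ¬$ (q ˢ)) (sym (dual-QF qf)))
    (⇒I (⇒I (∨E (apply (ˢ⇒∨$-QF qf nd) #0) (⊥E (⇒E #2 #0)) #0)))

  mutual
    ⇒ˢ-Σ : ∀ {j φ} → NoDollar φ → Sigma j φ → T ⊢ [] ∶ φ ⇒ φ ˢ
    ⇒ˢ-Σ nd (Σ0 q) = ⇒ˢ-QF q nd
    ⇒ˢ-Σ nd (Σbase p) = ⇒ˢ-Π nd p
    ⇒ˢ-Σ nd (Σ∃ s) = ⇒I (⇒I (⇒E #0 (apply (∃-mono (⇒ˢ-Σ nd s)) #1)))

    ⇒ˢ-Π : ∀ {j φ} → NoDollar φ → Pi j φ → T ⊢ [] ∶ φ ⇒ φ ˢ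
    ⇒ˢ-Π nd (Π0 q) = ⇒ˢ-QF q nd
    ⇒ˢ-Π nd (Πbase s) = ⇒ˢ-Σ nd s
    ⇒ˢ-Π nd (Π∀ p) = ∀-mono (⇒ˢ-Π nd p)

  mutual
    dual⇒¬$ˢ-Σ : ∀ {j φ} → NoDollar φ → Sigma j φ → T ⊢ [] ∶ dual φ ⇒ ¬$ (φ ˢ)
    dual⇒¬$ˢ-Σ nd (Σ0 q) = dual⇒¬$ˢ-QF q nd
    dual⇒¬$ˢ-Σ nd (Σbase p) = dual⇒¬$ˢ-Π nd p
    dual⇒¬$ˢ-Σ nd (Σ∃ s) =
      ⇒I (⇒I (⇒E #0 (⇒I (∃E #0 (⇒E (apply (dual⇒¬$ˢ-Σ nd s) (∀E-var0 #3)) #0)))))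

    dual⇒¬$ˢ-Π : ∀ {j φ} → NoDollar φ → Pi j φ → T ⊢ [] ∶ dual φ ⇒ ¬$ (φ ˢ)
    dual⇒¬$ˢ-Π nd (Π0 q) = dual⇒¬$ˢ-QF q nd
    dual⇒¬$ˢ-Π nd (Πbase s) = dual⇒¬$ˢ-Σ nd s
    dual⇒¬$ˢ-Π nd (Π∀ p) = ⇒I (⇒I (∃E #1 (⇒E (apply (dual⇒¬$ˢ-Π nd p) #0) (∀E-var0 #1))))

  decide-dual-QF : ∀ {q} → QF q → NoDollar q → T ⊢ [] ∶ q ∨ dual q
  decide-dual-QF {q} qf nd = cast (cong (q ∨_) (sym (dual-QF qf))) (decide-QF qf nd)

  mutual
    decide-dual-Σ : ∀ {j φ} → LEM T j → NoDollar φ → Sigma j φ → T ⊢ [] ∶ φ ∨ dual φ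
    decide-dual-Σ _ nd (Σ0 q) = decide-dual-QF q nd
    decide-dual-Σ lemⱼ nd (Σbase p) = decide-dual-Π (LEM-pred lemⱼ) nd p
    decide-dual-Σ lemⱼ nd (Σ∃ s) =
      ∨E (weaken₀ (lemⱼ nd (Σ∃ s))) (∨I₁ #0)
         (∨I₂ (∀I (∨E (weaken₀ (decide-dual-Σ lemⱼ nd s)) (⊥E (⇒E #1 (∃I-var0 #0))) #0)))

    decide-dual-Π : ∀ {j φ} → LEM T j → NoDollar φ → Pi j φ → T ⊢ [] ∶ φ ∨ dual φ
    decide-dual-Π _ nd (Π0 q) = decide-dual-QF q nd
    decide-dual-Π lemⱼ nd (Πbase s) = decide-dual-Σ (LEM-pred lemⱼ) nd s
    decide-dual-Π {φ = ∀' ψ} lemⱼ nd (Π∀ p) =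
      ∨E (weaken₀ (lemⱼ (NoDollar-dual ψ nd) (Σ∃ (dual-Π p)))) (∨I₂ #0)
         (∨I₁ (∀I (∨E (weaken₀ (decide-dual-Π lemⱼ nd p)) #0 (⊥E (⇒E #1 (∃I-var0 #0))))))

  ˢ⇔∨$ : ∀ {φ} → T ⊢ [] ∶ φ ∨ dual φ → T ⊢ [] ∶ dual φ ⇒ ¬$ (φ ˢ) → T ⊢ [] ∶ φ ⇒ φ ˢ →
         T ⊢ [] ∶ φ ˢ ⇔ (φ ∨ $)
  ˢ⇔∨$ {φ} φ∨dual dual⇒¬$ˢ φ⇒ˢ =
    ∧I (⇒I (∨E (weaken₀ φ∨dual) (∨I₁ #0) (∨I₂ (⇒E (apply dual⇒¬$ˢ #0) #1))))
       (⇒I (∨E #0 (apply φ⇒ˢ #0) (apply ($⇒ˢ φ) #0)))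

  ˢ⇔∨$-Σ : ∀ {j φ} → LEM T j → NoDollar φ → Sigma j φ → T ⊢ [] ∶ φ ˢ ⇔ (φ ∨ $)
  ˢ⇔∨$-Σ lemⱼ nd s = ˢ⇔∨$ (decide-dual-Σ lemⱼ nd s) (dual⇒¬$ˢ-Σ nd s) (⇒ˢ-Σ nd s)

  ˢ⇔∨$-Π : ∀ {j φ} → LEM T j → NoDollar φ → Pi j φ → T ⊢ [] ∶ φ ˢ ⇔ (φ ∨ $)
  ˢ⇔∨$-Π lemⱼ nd p = ˢ⇔∨$ (decide-dual-Π lemⱼ nd p) (dual⇒¬$ˢ-Π nd p) (⇒ˢ-Π nd p)

lemma3p5 : (k : ℕ) (φ : Form) → NoDollar φ →
    (Pi k φ → HA$+LEM k ⊢ [] ∶ (φ ˢ) ⇔ (φ ∨ $))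
    × (Sigma k φ → HA$+LEM k ⊢ [] ∶ (φ ˢ) ⇔ (φ ∨ $))
lemma3p5 k φ nd = ˢ⇔∨$-Π lemₖ nd , ˢ⇔∨$-Σ lemₖ nd
  where
  lemₖ : LEM (HA$+LEM k) k
  lemₖ nd′ s = ax (lem nd′ s)

  open DollarTranslation (HA$+LEM k) (LEM-zero k lemₖ)
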